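{- Let $(X,\Sigma)$ be an implicational base with closure operator $\phi$, let $\mathcal{B}^+$ be an antichain of $\mathcal{L}(\Sigma)$, let $\mathcal{B}^-$ be the dual antichain of $\mathcal{B}^+$ in $\mathcal{L}(\Sigma)$, and let $\mathcal{H}=\{X\setminus B\mid B\in\mathcal{B}^+\}$. Then for every transversal $T$ of $\mathcal{H}$ there exists $I\in\mathcal{B}^-$ with $I\subseteq\phi(T)$. In particular this holds for every minimal transversal of $\mathcal{H}$.
   Context: An implicational base $(X,\Sigma)$ is a finite set $X$ with a finite set $\Sigma$ of implications $A\rightarrow b$, $A\subseteq X$, $b\in X$. A set $C\subseteq X$ is closed if for every $A\rightarrow b\in\Sigma$, $b\in C$ or $A\not\subseteq C$; $\phi(C)$ is the smallest closed set containing $C$. $\mathcal{L}(\Sigma)$ is the lattice of closed sets ordered by inclusion; an antichain is a family of pairwise inclusion-incomparable closed sets. Antichains $\mathcal{B}^+,\mathcal{B}^-$ are dual in $\mathcal{L}(\Sigma)$ if every closed set is contained in a member of $\mathcal{B}^+$ or contains a member of $\mathcal{B}^-$, but not both. A transversal of a hypergraph $\mathcal{H}\subseteq 2^X$ is a set $T\subseteq X$ meeting every hyperedge; it is minimal if minimal under inclusion. -}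

module Defs where

open import Data.Nat using (ℕ)
open import Data.Fin using (Fin)
open import Data.Fin.Subset using (Subset; _∈_; _∉_; _⊆_; ∁)
open import Data.List using (List)
import Data.List.Membership.Propositional as LM
open import Data.Product using (_×_; ∃-syntax; proj₁; proj₂)
open import Data.Sum using (_⊎_)
open import Relation.Nullary using (¬_)
open import Relation.Binary.PropositionalEquality using (_≡_)

Implication : ℕ → Set
Implication n = Subset n × Fin n

Base : ℕ → Set
Base n = List (Implication n)

Closed : ∀ {n} → Base n → Subset n → Set
Closed Σ C = ∀ imp → imp LM.∈ Σ → proj₂ imp ∈ C ⊎ ¬ (proj₁ imp ⊆ C)

IsClosureOf : ∀ {n} → Base n → Subset n → Subset n → Set
IsClosureOf Σ T C = Closed Σ C × T ⊆ C × (∀ D → Closed Σ D → T ⊆ D → C ⊆ D)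

Antichain : ∀ {n} → Base n → List (Subset n) → Set
Antichain Σ 𝓑 =
  (∀ B → B LM.∈ 𝓑 → Closed Σ B) ×
  (∀ B B' → B LM.∈ 𝓑 → B' LM.∈ 𝓑 → B ⊆ B' → B ≡ B')

Dual : ∀ {n} → Base n → List (Subset n) → List (Subset n) → Set
Dual Σ 𝓑⁺ 𝓑⁻ = ∀ C → Closed Σ C →
  ((∃[ B ] (B LM.∈ 𝓑⁺ × C ⊆ B)) ⊎ (∃[ I ] (I LM.∈ 𝓑⁻ × I ⊆ C))) ×
  ¬ ((∃[ B ] (B LM.∈ 𝓑⁺ × C ⊆ B)) × (∃[ I ] (I LM.∈ 𝓑⁻ × I ⊆ C)))

-- H = { X \ B | B ∈ B⁺ }; T is a transversal of H iff T meets X \ B for every B ∈ B⁺.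
Transversal : ∀ {n} → List (Subset n) → Subset n → Set
Transversal H T = ∀ E → E LM.∈ H → ∃[ x ] (x ∈ T × x ∈ E)

module Submission where

open import Defs
open import Data.Nat using (ℕ)
open import Data.Fin.Subset using (Subset; _⊆_; ∁)
open import Data.Fin.Subset.Properties using (x∈∁p⇒x∉p)
open import Data.List using (List; map)
import Data.List.Membership.Propositional as LM
open import Data.List.Membership.Propositional.Properties using (∈-map⁺)
open import Data.Product using (_×_; ∃-syntax; _,_)
open import Data.Sum using (inj₁; inj₂)
open import Relation.Nullary using (¬_; contradiction)

-- φ(T) is closed, so by duality it lies below some B ∈ 𝓑⁺ or above some I ∈ 𝓑⁻;
-- the first is impossible since T ⊆ φ(T) meets X \ B.

transversal-∁⇒⊈ : ∀ {n} {𝓑 : List (Subset n)} {T B : Subset n} →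
  Transversal (map ∁ 𝓑) T → B LM.∈ 𝓑 → ¬ T ⊆ B
transversal-∁⇒⊈ {B = B} tr B∈𝓑 T⊆B with tr (∁ B) (∈-map⁺ ∁ B∈𝓑)
... | x , x∈T , x∈∁B = x∈∁p⇒x∉p x∈∁B (T⊆B x∈T)

dual-⊈⁺⇒⊇⁻ : ∀ {n} {Σ : Base n} {𝓑⁺ 𝓑⁻ : List (Subset n)} → Dual Σ 𝓑⁺ 𝓑⁻ →
  ∀ {C} → Closed Σ C → ¬ (∃[ B ] (B LM.∈ 𝓑⁺ × C ⊆ B)) →
  ∃[ I ] (I LM.∈ 𝓑⁻ × I ⊆ C)
dual-⊈⁺⇒⊇⁻ dual {C} closed notBelow with dual C closed
... | inj₁ below , _ = contradiction below notBelow
... | inj₂ above , _ = above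

lemma1 : ∀ (n : ℕ) (Σ : Base n) (𝓑⁺ 𝓑⁻ : List (Subset n)) →
    Antichain Σ 𝓑⁺ → Antichain Σ 𝓑⁻ → Dual Σ 𝓑⁺ 𝓑⁻ →
    ∀ (T : Subset n) → Transversal (map ∁ 𝓑⁺) T →
    ∀ (φT : Subset n) → IsClosureOf Σ T φT →
    ∃[ I ] (I LM.∈ 𝓑⁻ × I ⊆ φT)
lemma1 n Σ 𝓑⁺ 𝓑⁻ _ _ dual T tr φT (closed , T⊆φT , _) =
  dual-⊈⁺⇒⊇⁻ dual closed φT⊈𝓑⁺
  where
  φT⊈𝓑⁺ : ¬ (∃[ B ] (B LM.∈ 𝓑⁺ × φT ⊆ B))
  φT⊈𝓑⁺ (B , B∈𝓑⁺ , φT⊆B) = transversal-∁⇒⊈ tr B∈𝓑⁺ (λ x∈T → φT⊆B (T⊆φT x∈T))
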